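{- Let $k\geq 1$, $n=8k+3$, $G=C(n,\pm\{1,2,3,4\})$, and $a\in\mathbb{Z}_n$. If $X\subseteq V(G)$ resolves $A=(\{a,a+1\},\{a+2,a+3\},\{a+4,a+5\})$ (indices mod $n$), then $|X|\geq 2$.
   Context: $C(n,\pm\{1,2,3,4\})$ is the graph on $\mathbb{Z}_n$ where distinct $i,j$ are adjacent iff $j-i\equiv\pm s\pmod n$ for some $s\in\{1,2,3,4\}$; $d$ is graph distance, and $r(v|X)=(d(v,x))_{x\in X}$. A set $X$ resolves a tuple of sets $(A_1,\dots,A_p)$ if $r(a|X)\neq r(b|X)$ for all distinct $a,b$ lying in the same $A_j$. -}

module Defs where

open import Data.Nat using (ℕ; zero; suc; _+_; _*_; _<_; NonZero)
open import Data.Nat.DivMod using (_%_)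
open import Data.Fin using (Fin; toℕ; fromℕ<)
open import Data.Fin.Subset using (Subset; _∈_)
open import Data.Nat.DivMod using (m%n<n)
open import Data.Product using (Σ; ∃; _×_)
open import Data.Sum using (_⊎_)
open import Relation.Binary.PropositionalEquality using (_≡_; _≢_)
open import Relation.Nullary using (¬_)
open import Data.List using (List; []; _∷_)
open import Data.List.Membership.Propositional renaming (_∈_ to _∈ₗ_)

_⊕_ : ∀ {n} .{{_ : NonZero n}} → Fin n → ℕ → Fin n
_⊕_ {n} i s = fromℕ< (m%n<n (toℕ i + s) n)

Gen : ℕ → Set
Gen s = (s ≡ 1) ⊎ (s ≡ 2) ⊎ (s ≡ 3) ⊎ (s ≡ 4)

Adj : ∀ n .{{_ : NonZero n}} → Fin n → Fin n → Set
Adj n i j = (i ≢ j) × (∃ λ s → Gen s × ((j ≡ i ⊕ s) ⊎ (i ≡ j ⊕ s)))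

Walk : ∀ n .{{_ : NonZero n}} → ℕ → Fin n → Fin n → Set
Walk n zero u v = u ≡ v
Walk n (suc t) u v = ∃ λ w → Walk n t u w × Adj n w v

Dist : ∀ n .{{_ : NonZero n}} → Fin n → Fin n → ℕ → Set
Dist n u v t = Walk n t u v × (∀ s → s < t → ¬ Walk n s u v)

Distinguishes : ∀ n .{{_ : NonZero n}} → Subset n → Fin n → Fin n → Set
Distinguishes n X a b =
  ∃ λ x → (x ∈ X) × (∃ λ t₁ → ∃ λ t₂ → Dist n a x t₁ × Dist n b x t₂ × (t₁ ≢ t₂))

Resolves : ∀ n .{{_ : NonZero n}} → Subset n → List (List (Fin n)) → Set
Resolves n X As = ∀ A → A ∈ₗ As → ∀ u v → u ∈ₗ A → v ∈ₗ A → u ≢ v → Distinguishes n X u v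

tupleA : ∀ {n} .{{_ : NonZero n}} → Fin n → List (List (Fin n))
tupleA a = (a ⊕ 0 ∷ a ⊕ 1 ∷ []) ∷ (a ⊕ 2 ∷ a ⊕ 3 ∷ []) ∷ (a ⊕ 4 ∷ a ⊕ 5 ∷ []) ∷ []

-- In C(n, ±{1,2,3,4}) the vertex x + m is at distance ⌈min(m, n - m)/4⌉ from x:
-- a walk of length t moves at most 4t around the cycle, and jumps of length 4
-- attain this.  For n = 8k + 3 the distance from x is therefore constant on the
-- blocks {4q+1, ..., 4q+4} of either arc, on the middle block {4k+1, 4k+2} and on
-- {0}.  A pair {a+j, a+j+1} is equidistant from x unless a block boundary separates
-- it.  The pairs of A start at a, a+2, a+4, so all three are separated only if two
-- consecutive boundaries are 2 apart; but the gaps between boundaries are 4, except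
-- for a single gap of 2 and a single gap of 1.  So one landmark never resolves A.
module Submission where

open import Defs
open import Data.Fin using (Fin; toℕ; fromℕ<)
open import Data.Fin.Patterns using (0F; 1F; 2F; 3F)
open import Data.Fin.Properties using (toℕ-fromℕ<; toℕ<n; toℕ-injective; fromℕ<-injective)
open import Data.Fin.Subset using (Subset; ∣_∣; _∈_; _-_)
open import Data.Fin.Subset.Properties using (x∈p∧x≢y⇒x∈p-y; x∈p⇒∣p-x∣<∣p∣)
open import Data.List using (_∷_; [])
open import Data.List.Relation.Unary.Any using (here; there)
open import Data.Nat using (ℕ; zero; suc; pred; _+_; _*_; _≤_; _<_; _≤?_; _<?_; NonZero; z≤n; s≤s; >-nonZero⁻¹)
open import Data.Nat.DivMod using (_%_; _divMod_; result; m%n%n≡m%n; %-distribˡ-+; [m+kn]%n≡m%n; m<n⇒m%n≡m)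
open import Data.Nat.Properties
open import Data.Nat.Tactic.RingSolver using (solve)
open import Data.Product using (∃; _×_; _,_; proj₁; proj₂)
open import Data.Sum using (_⊎_; inj₁; inj₂)
open import Function using (case_of_)
open import Relation.Binary.PropositionalEquality
open import Relation.Nullary using (¬_; yes; no; contradiction)

[m%n+k]%n≡[m+k]%n : ∀ m k n .{{_ : NonZero n}} → (m % n + k) % n ≡ (m + k) % n
[m%n+k]%n≡[m+k]%n m k n = begin
  (m % n + k) % n          ≡⟨ %-distribˡ-+ (m % n) k n ⟩
  (m % n % n + k % n) % n  ≡⟨ cong (λ i → (i + k % n) % n) (m%n%n≡m%n m n) ⟩
  (m % n + k % n) % n      ≡⟨ %-distribˡ-+ m k n ⟨
  (m + k) % n              ∎
  where open ≡-Reasoning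

quotient-< : ∀ {q K d} r → r + q * d < K * d → q < K
quotient-< {q} {K} {d} r lt = *-cancelʳ-< d q K (≤-<-trans (m≤n+m (q * d) r) lt)

x∈p∧y∈p∧x≢y⇒2≤∣p∣ : ∀ {m} {X : Subset m} {x y} → x ∈ X → y ∈ X → x ≢ y → 2 ≤ ∣ X ∣
x∈p∧y∈p∧x≢y⇒2≤∣p∣ {X = X} {x} x∈X y∈X x≢y = ≤-trans (s≤s 1≤∣X-x∣) (x∈p⇒∣p-x∣<∣p∣ x∈X)
  where
  1≤∣X-x∣ : 1 ≤ ∣ X - x ∣
  1≤∣X-x∣ = ≤-trans (s≤s z≤n) (x∈p⇒∣p-x∣<∣p∣ (x∈p∧x≢y⇒x∈p-y y∈X (≢-sym x≢y)))

module _ {n : ℕ} .{{_ : NonZero n}} where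

  toℕ-⊕ : (y : Fin n) (s : ℕ) → toℕ (y ⊕ s) ≡ (toℕ y + s) % n
  toℕ-⊕ y s = toℕ-fromℕ< _

  ⊕-+ : (y : Fin n) (s t : ℕ) → (y ⊕ s) ⊕ t ≡ y ⊕ (s + t)
  ⊕-+ y s t = toℕ-injective (begin
    toℕ ((y ⊕ s) ⊕ t)          ≡⟨ toℕ-⊕ (y ⊕ s) t ⟩
    (toℕ (y ⊕ s) + t) % n      ≡⟨ cong (λ i → (i + t) % n) (toℕ-⊕ y s) ⟩
    ((toℕ y + s) % n + t) % n  ≡⟨ [m%n+k]%n≡[m+k]%n (toℕ y + s) t n ⟩
    (toℕ y + s + t) % n        ≡⟨ cong (_% n) (+-assoc (toℕ y) s t) ⟩
    (toℕ y + (s + t)) % n      ≡⟨ toℕ-⊕ y (s + t) ⟨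
    toℕ (y ⊕ (s + t))          ∎)
    where open ≡-Reasoning

  ⊕-multiple : (y : Fin n) (k : ℕ) → y ⊕ (k * n) ≡ y
  ⊕-multiple y k = toℕ-injective (begin
    toℕ (y ⊕ (k * n))    ≡⟨ toℕ-⊕ y (k * n) ⟩
    (toℕ y + k * n) % n  ≡⟨ [m+kn]%n≡m%n (toℕ y) k n ⟩
    toℕ y % n            ≡⟨ m<n⇒m%n≡m (toℕ<n y) ⟩
    toℕ y                ∎)
    where open ≡-Reasoning

  ⊕-identityʳ : (y : Fin n) → y ⊕ 0 ≡ y
  ⊕-identityʳ y = ⊕-multiple y 0

  ⊕-n : (y : Fin n) → y ⊕ n ≡ y
  ⊕-n y = trans (cong (y ⊕_) (sym (+-identityʳ n))) (⊕-multiple y 1)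

  s+pred[n]*s≡s*n : ∀ s → s + pred n * s ≡ s * n
  s+pred[n]*s≡s*n s = trans (cong (_* s) (suc-pred n)) (*-comm n s)

  ⊕-cancelʳ : ∀ {u v : Fin n} {s} → u ⊕ s ≡ v ⊕ s → u ≡ v
  ⊕-cancelʳ {u} {v} {s} e = trans (sym (undo u)) (trans (cong (_⊕ (pred n * s)) e) (undo v))
    where
    undo : ∀ y → (y ⊕ s) ⊕ (pred n * s) ≡ y
    undo y = trans (⊕-+ y s _) (trans (cong (y ⊕_) (s+pred[n]*s≡s*n s)) (⊕-multiple y s))

  ⊕-toℕ-comm : (y z : Fin n) → y ⊕ toℕ z ≡ z ⊕ toℕ y
  ⊕-toℕ-comm y z = toℕ-injective (begin
    toℕ (y ⊕ toℕ z)      ≡⟨ toℕ-⊕ y (toℕ z) ⟩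
    (toℕ y + toℕ z) % n  ≡⟨ cong (_% n) (+-comm (toℕ y) (toℕ z)) ⟩
    (toℕ z + toℕ y) % n  ≡⟨ toℕ-⊕ z (toℕ y) ⟨
    toℕ (z ⊕ toℕ y)      ∎)
    where open ≡-Reasoning

  ⊕-injectiveʳ : (y : Fin n) {s t : ℕ} (s<n : s < n) (t<n : t < n) → y ⊕ s ≡ y ⊕ t → s ≡ t
  ⊕-injectiveʳ y {s} {t} s<n t<n e =
    fromℕ<-injective s t s<n t<n (⊕-cancelʳ (trans (sym (swap s<n)) (trans e (swap t<n))))
    where
    swap : ∀ {i} (i<n : i < n) → y ⊕ i ≡ fromℕ< i<n ⊕ toℕ y
    swap i<n = trans (cong (y ⊕_) (sym (toℕ-fromℕ< i<n))) (⊕-toℕ-comm y (fromℕ< i<n))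

  ⊕-aperiodic : (y : Fin n) {s : ℕ} → 0 < s → s < n → y ⊕ s ≢ y
  ⊕-aperiodic y 0<s s<n e =
    <⇒≢ 0<s (sym (⊕-injectiveʳ y s<n (>-nonZero⁻¹ n) (trans e (sym (⊕-identityʳ y)))))

  offset : (x a : Fin n) → ∃ λ o → o < n × x ⊕ o ≡ a
  offset x a = toℕ z , toℕ<n z , (begin
    x ⊕ toℕ z                     ≡⟨ ⊕-toℕ-comm x z ⟩
    z ⊕ toℕ x                     ≡⟨ ⊕-+ a (pred n * toℕ x) (toℕ x) ⟩
    a ⊕ (pred n * toℕ x + toℕ x)  ≡⟨ cong (a ⊕_) (+-comm (pred n * toℕ x) (toℕ x)) ⟩
    a ⊕ (toℕ x + pred n * toℕ x)  ≡⟨ cong (a ⊕_) (s+pred[n]*s≡s*n (toℕ x)) ⟩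
    a ⊕ (toℕ x * n)               ≡⟨ ⊕-multiple a (toℕ x) ⟩
    a                             ∎)
    where
    open ≡-Reasoning
    z : Fin n
    z = a ⊕ (pred n * toℕ x)

-- Layer n q m: in C(n, ±{1,2,3,4}) the vertex at offset m from a vertex x is
-- at distance q + 1 from x.  A near offset lies on the shorter arc and is
-- reached by q + 1 jumps of length at most 4; far reflects it to n - m, wrap
-- adds a full turn.
data Layer (n q : ℕ) : ℕ → Set where
  near : ∀ {m} (r : Fin 4) → suc (toℕ r) + q * 4 ≡ m → m + m ≤ n → Layer n q m
  far  : ∀ {m m'} → Layer n q m → m + m' ≡ n → Layer n q m'
  wrap : ∀ {m m'} → Layer n q m → n + m ≡ m' → Layer n q m'

SameLayer : ℕ → ℕ → Set
SameLayer n m = ∃ λ q → Layer n q m × Layer n q (suc m)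

module Distance (n : ℕ) .{{_ : NonZero n}} (5≤n : 5 ≤ n) where

  adj-sym : ∀ {u v} → Adj n u v → Adj n v u
  adj-sym (u≢v , s , g , inj₁ e) = ≢-sym u≢v , s , g , inj₂ e
  adj-sym (u≢v , s , g , inj₂ e) = ≢-sym u≢v , s , g , inj₁ e

  walk-prepend : ∀ {t u w v} → Adj n u w → Walk n t w v → Walk n (suc t) u v
  walk-prepend {zero} e refl = _ , refl , e
  walk-prepend {suc t} e (w' , p , e') = w' , walk-prepend e p , e'

  walk-reverse : ∀ {t u v} → Walk n t u v → Walk n t v u
  walk-reverse {zero} refl = refl
  walk-reverse {suc t} (w , p , e) = walk-prepend (adj-sym e) (walk-reverse p)

  dist-sym : ∀ {u v t} → Dist n u v t → Dist n v u t
  dist-sym (p , shortest) = walk-reverse p , λ s s<t p' → shortest s s<t (walk-reverse p')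

  dist-unique : ∀ {u v t t'} → Dist n u v t → Dist n u v t' → t ≡ t'
  dist-unique (p , shortest) (p' , shortest') =
    ≤-antisym (≮⇒≥ λ t'<t → shortest _ t'<t p') (≮⇒≥ λ t<t' → shortest' _ t<t' p)

  Near : ℕ → Fin n → Fin n → Set
  Near c u v = ∃ λ s → s ≤ c × (v ≡ u ⊕ s ⊎ u ≡ v ⊕ s)

  near-common-base : ∀ {c} (w : Fin n) {s s'} → s ≤ c → s' ≤ c → Near c (w ⊕ s) (w ⊕ s')
  near-common-base w {s} {s'} s≤c s'≤c with ≤-total s s'
  ... | inj₁ s≤s' with m≤n⇒∃[o]m+o≡n s≤s'
  ...   | d , refl = d , ≤-trans (m≤n+m d s) s'≤c , inj₁ (sym (⊕-+ w s d))
  near-common-base w {s} {s'} s≤c s'≤c | inj₂ s'≤s with m≤n⇒∃[o]m+o≡n s'≤s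
  ...   | d , refl = d , ≤-trans (m≤n+m d s') s≤c , inj₂ (sym (⊕-+ w s' d))

  near-common-top : ∀ {c u v s s'} → u ⊕ s ≡ v ⊕ s' → s ≤ c → s' ≤ c → Near c u v
  near-common-top {u = u} {v} {s} {s'} e s≤c s'≤c with ≤-total s s'
  ... | inj₁ s≤s' with m≤n⇒∃[o]m+o≡n s≤s'
  ...   | d , refl = d , ≤-trans (m≤n+m d s) s'≤c ,
          inj₂ (⊕-cancelʳ (trans e (trans (cong (v ⊕_) (+-comm s d)) (sym (⊕-+ v d s)))))
  near-common-top {u = u} {v} {s} {s'} e s≤c s'≤c | inj₂ s'≤s with m≤n⇒∃[o]m+o≡n s'≤s
  ...   | d , refl = d , ≤-trans (m≤n+m d s') s≤c ,
          inj₁ (⊕-cancelʳ (trans (sym e) (trans (cong (u ⊕_) (+-comm s' d)) (sym (⊕-+ u d s')))))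

  near-trans : ∀ {a b u w v} → Near a u w → Near b w v → Near (a + b) u v
  near-trans {a} {b} {u} (s , s≤a , inj₁ refl) (s' , s'≤b , inj₁ refl) =
    s + s' , +-mono-≤ s≤a s'≤b , inj₁ (⊕-+ u s s')
  near-trans {a} {b} {v = v} (s , s≤a , inj₂ refl) (s' , s'≤b , inj₂ refl) =
    s' + s , ≤-trans (≤-reflexive (+-comm s' s)) (+-mono-≤ s≤a s'≤b) , inj₂ (⊕-+ v s' s)
  near-trans {a} {b} (s , s≤a , inj₁ w≡u⊕s) (s' , s'≤b , inj₂ w≡v⊕s') =
    near-common-top (trans (sym w≡u⊕s) w≡v⊕s') (≤-trans s≤a (m≤m+n a b)) (≤-trans s'≤b (m≤n+m b a))
  near-trans {a} {b} {w = w} (s , s≤a , inj₂ refl) (s' , s'≤b , inj₁ refl) =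
    near-common-base w (≤-trans s≤a (m≤m+n a b)) (≤-trans s'≤b (m≤n+m b a))

  gen⇒≤4 : ∀ {s} → Gen s → s ≤ 4
  gen⇒≤4 (inj₁ refl) = s≤s z≤n
  gen⇒≤4 (inj₂ (inj₁ refl)) = s≤s (s≤s z≤n)
  gen⇒≤4 (inj₂ (inj₂ (inj₁ refl))) = s≤s (s≤s (s≤s z≤n))
  gen⇒≤4 (inj₂ (inj₂ (inj₂ refl))) = ≤-refl

  walk⇒near : ∀ {t u v} → Walk n t u v → Near (t * 4) u v
  walk⇒near {zero} refl = 0 , z≤n , inj₁ (sym (⊕-identityʳ _))
  walk⇒near {suc t} {u} {v} (w , p , (_ , s , g , e)) =
    subst (λ c → Near c u v) (+-comm (t * 4) 4) (near-trans (walk⇒near p) (s , gen⇒≤4 g , e))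

  near⇒≤ : ∀ {c m} (y : Fin n) → m + m ≤ n → Near c (y ⊕ m) y → m ≤ c
  near⇒≤ {c} {m} y m+m≤n (s , s≤c , e) with m ≤? s
  ... | yes m≤s = ≤-trans m≤s s≤c
  ... | no m≰s = contradiction e impossible
    where
    s<m : s < m
    s<m = ≰⇒> m≰s
    0<m : 0 < m
    0<m = ≤-<-trans z≤n s<m
    m<n : m < n
    m<n = <-≤-trans (m<m+n m 0<m) m+m≤n
    impossible : ¬ (y ≡ (y ⊕ m) ⊕ s ⊎ y ⊕ m ≡ y ⊕ s)
    impossible (inj₁ e) = <⇒≢ (≤-trans 0<m (m≤m+n m s))
      (⊕-injectiveʳ y (>-nonZero⁻¹ n) (<-≤-trans (+-monoʳ-< m s<m) m+m≤n)
        (trans (⊕-identityʳ y) (trans e (⊕-+ y m s))))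
    impossible (inj₂ e) = <⇒≢ s<m (sym (⊕-injectiveʳ y m<n (<-trans s<m m<n) e))

  gen-suc : (r : Fin 4) → Gen (suc (toℕ r))
  gen-suc 0F = inj₁ refl
  gen-suc 1F = inj₂ (inj₁ refl)
  gen-suc 2F = inj₂ (inj₂ (inj₁ refl))
  gen-suc 3F = inj₂ (inj₂ (inj₂ refl))

  ⊕-adj : (y : Fin n) (r : Fin 4) → Adj n (y ⊕ suc (toℕ r)) y
  ⊕-adj y r = ⊕-aperiodic y (s≤s z≤n) (<-≤-trans (s≤s (toℕ<n r)) 5≤n) , suc (toℕ r) , gen-suc r , inj₂ refl

  ⊕-walk : (y : Fin n) (q : ℕ) (r : Fin 4) → Walk n (suc q) (y ⊕ (suc (toℕ r) + q * 4)) y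
  ⊕-walk y zero r = _ , refl , subst (λ i → Adj n (y ⊕ i) y) (sym (+-identityʳ _)) (⊕-adj y r)
  ⊕-walk y (suc q) r =
    y ⊕ 4 , subst (λ u → Walk n (suc q) u (y ⊕ 4)) start (⊕-walk (y ⊕ 4) q r) , ⊕-adj y 3F
    where
    start : (y ⊕ 4) ⊕ (suc (toℕ r) + q * 4) ≡ y ⊕ (suc (toℕ r) + (4 + q * 4))
    start = trans (⊕-+ y 4 (suc (toℕ r) + q * 4)) (cong (y ⊕_) (begin
      4 + (suc (toℕ r) + q * 4)  ≡⟨ +-assoc 4 (suc (toℕ r)) (q * 4) ⟨
      4 + suc (toℕ r) + q * 4    ≡⟨ cong (_+ q * 4) (+-comm 4 (suc (toℕ r))) ⟩
      suc (toℕ r) + 4 + q * 4    ≡⟨ +-assoc (suc (toℕ r)) 4 (q * 4) ⟩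
      suc (toℕ r) + (4 + q * 4)  ∎))
      where open ≡-Reasoning

  ⊕-dist : (y : Fin n) {q m : ℕ} (r : Fin 4) → suc (toℕ r) + q * 4 ≡ m → m + m ≤ n →
           Dist n (y ⊕ m) y (suc q)
  ⊕-dist y {q} r refl m+m≤n = ⊕-walk y q r , no-shorter
    where
    no-shorter : ∀ t → t < suc q → ¬ Walk n t (y ⊕ (suc (toℕ r) + q * 4)) y
    no-shorter t t<1+q p =
      <⇒≱ (quotient-< {q} {t} {4} (toℕ r) (near⇒≤ y m+m≤n (walk⇒near p))) (m<1+n⇒m≤n t<1+q)

  layer-dist : ∀ {q m} → Layer n q m → (x : Fin n) → Dist n (x ⊕ m) x (suc q)
  layer-dist (near r e m+m≤n) x = ⊕-dist x r e m+m≤n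
  layer-dist {q} (far {m} {m'} L e) x =
    dist-sym (subst (λ v → Dist n v (x ⊕ m') (suc q)) back (layer-dist L (x ⊕ m')))
    where
    back : (x ⊕ m') ⊕ m ≡ x
    back = trans (⊕-+ x m' m) (trans (cong (x ⊕_) (trans (+-comm m' m) e)) (⊕-n x))
  layer-dist {q} (wrap {m} L e) x = subst (λ v → Dist n v x (suc q)) turn (layer-dist L x)
    where
    turn : x ⊕ m ≡ x ⊕ _
    turn = trans (cong (_⊕ m) (sym (⊕-n x))) (trans (⊕-+ x n m) (cong (x ⊕_) e))

  Equidistant : Fin n → Fin n → Fin n → Set
  Equidistant x u v = ∀ {t₁ t₂} → Dist n u x t₁ → Dist n v x t₂ → t₁ ≡ t₂

  sameLayer⇒equidistant : ∀ (x : Fin n) o j → SameLayer n (o + j) →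
                          Equidistant x ((x ⊕ o) ⊕ j) ((x ⊕ o) ⊕ suc j)
  sameLayer⇒equidistant x o j (q , L , L') d d' =
    trans (dist-unique d (subst (λ v → Dist n v x (suc q)) (sym (⊕-+ x o j)) (layer-dist L x)))
          (dist-unique (subst (λ v → Dist n v x (suc q)) next (layer-dist L' x)) d')
    where
    next : x ⊕ suc (o + j) ≡ (x ⊕ o) ⊕ suc j
    next = trans (cong (x ⊕_) (sym (+-suc o j))) (sym (⊕-+ x o (suc j)))

  equidistant⇒2≤∣X∣ : ∀ {X : Subset n} {x u v} → x ∈ X → Distinguishes n X u v → Equidistant x u v →
                      2 ≤ ∣ X ∣
  equidistant⇒2≤∣X∣ {x = x} x∈X (y , y∈X , _ , _ , d , d' , t≢t') equidistant =
    x∈p∧y∈p∧x≢y⇒2≤∣p∣ x∈X y∈X x≢y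
    where
    x≢y : x ≢ y
    x≢y refl = t≢t' (equidistant d d')

  ⊕-≢-⊕suc : (y : Fin n) (j : ℕ) → y ⊕ j ≢ y ⊕ suc j
  ⊕-≢-⊕suc y j e = ⊕-aperiodic (y ⊕ j) (s≤s z≤n) (≤-trans (s≤s (s≤s z≤n)) 5≤n)
    (trans (⊕-+ y j 1) (trans (cong (y ⊕_) (+-comm j 1)) (sym e)))

module Order8k+3 (k : ℕ) where

  N : ℕ
  N = 3 + 8 * suc k

  fits : ∀ {m} → m ≤ suc (suc k * 4) → m + m ≤ N
  fits {m} le = ≤-trans (+-mono-≤ le le) (≤-trans (≤-reflexive double) (n≤1+n (2 + 8 * suc k)))
    where
    double : suc (suc k * 4) + suc (suc k * 4) ≡ 2 + 8 * suc k
    double = solve (k ∷ [])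

  nearLayer : ∀ {n' q m} → n' ≡ N → q ≤ k → (r : Fin 4) → suc (toℕ r) + q * 4 ≡ m → Layer n' q m
  nearLayer {q = q} refl q≤k r refl = near r refl (fits (≤-trans (≤-trans r+4q≤4+4q 4+4q≤4+4k) (n≤1+n _)))
    where
    r+4q≤4+4q : suc (toℕ r) + q * 4 ≤ suc q * 4
    r+4q≤4+4q = +-monoˡ-≤ (q * 4) (toℕ<n r)
    4+4q≤4+4k : suc q * 4 ≤ suc k * 4
    4+4q≤4+4k = *-monoˡ-≤ 4 (s≤s q≤k)

  lower-half : ∀ o → o < suc (suc k) * 4 → SameLayer N o ⊎ SameLayer N (o + 2) ⊎ SameLayer N (o + 4)
  lower-half o o<half with o divMod 4
  ... | result q r refl with m≤n⇒m<n∨m≡n (m<1+n⇒m≤n (quotient-< {q} {suc (suc k)} {4} (toℕ r) o<half)) | r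
  ... | inj₁ (s≤s q≤k) | 0F = inj₂ (inj₁ (q , nearLayer refl q≤k 1F (+-comm 2 (q * 4)) ,
                                             nearLayer refl q≤k 2F (solve (q ∷ []))))
  ... | inj₁ (s≤s q≤k) | 1F = inj₁ (q , nearLayer refl q≤k 0F refl , nearLayer refl q≤k 1F refl)
  ... | inj₁ (s≤s q≤k) | 2F = inj₁ (q , nearLayer refl q≤k 1F refl , nearLayer refl q≤k 2F refl)
  ... | inj₁ (s≤s q≤k) | 3F = inj₁ (q , nearLayer refl q≤k 2F refl , nearLayer refl q≤k 3F refl)
  ... | inj₂ refl | 0F = inj₂ (inj₂ (k , far (nearLayer refl ≤-refl 2F refl) (solve (k ∷ [])) ,
                                         far (nearLayer refl ≤-refl 1F refl) (solve (k ∷ []))))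
  ... | inj₂ refl | 1F = inj₁ (suc k , peak , far peak (solve (k ∷ [])))
    where
    peak : Layer N (suc k) (suc (suc k * 4))
    peak = near 0F refl (fits ≤-refl)
  ... | inj₂ refl | 2F = inj₂ (inj₁ (k , far (nearLayer refl ≤-refl 2F refl) (solve (k ∷ [])) ,
                                         far (nearLayer refl ≤-refl 1F refl) (solve (k ∷ []))))
  ... | inj₂ refl | 3F = inj₁ (k , far (nearLayer refl ≤-refl 3F refl) (solve (k ∷ [])) ,
                                  far (nearLayer refl ≤-refl 2F refl) (solve (k ∷ [])))

  upper-half : ∀ o p → suc o + p ≡ N → p < suc k * 4 →
               SameLayer (suc o + p) o ⊎ SameLayer (suc o + p) (o + 2) ⊎ SameLayer (suc o + p) (o + 4)
  upper-half o p e p<quarter with p divMod 4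
  ... | result zero 0F refl = inj₂ (inj₁ (0 , wrap (nearLayer e z≤n 0F refl) (solve (o ∷ [])) ,
                                            wrap (nearLayer e z≤n 1F refl) (solve (o ∷ []))))
  ... | result (suc q) 0F refl = inj₂ (inj₁ (q , far (nearLayer e q≤k 2F refl) (solve (o ∷ q ∷ [])) ,
                                                far (nearLayer e q≤k 1F refl) (solve (o ∷ q ∷ []))))
    where
    q≤k : q ≤ k
    q≤k = <⇒≤ (m<1+n⇒m≤n (quotient-< 0 p<quarter))
  ... | result q 1F refl = inj₁ (q , far (nearLayer e q≤k 1F refl) (solve (o ∷ q ∷ [])) ,
                                    far (nearLayer e q≤k 0F refl) (solve (o ∷ q ∷ [])))
    where
    q≤k : q ≤ k
    q≤k = m<1+n⇒m≤n (quotient-< 1 p<quarter)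
  ... | result q 2F refl = inj₁ (q , far (nearLayer e q≤k 2F refl) (solve (o ∷ q ∷ [])) ,
                                    far (nearLayer e q≤k 1F refl) (solve (o ∷ q ∷ [])))
    where
    q≤k : q ≤ k
    q≤k = m<1+n⇒m≤n (quotient-< 2 p<quarter)
  ... | result q 3F refl = inj₁ (q , far (nearLayer e q≤k 3F refl) (solve (o ∷ q ∷ [])) ,
                                    far (nearLayer e q≤k 2F refl) (solve (o ∷ q ∷ [])))
    where
    q≤k : q ≤ k
    q≤k = m<1+n⇒m≤n (quotient-< 3 p<quarter)

  sameLayer-among-three : ∀ o → o < N → SameLayer N o ⊎ SameLayer N (o + 2) ⊎ SameLayer N (o + 4)
  sameLayer-among-three o o<N with o <? suc (suc k) * 4
  ... | yes o<half = lower-half o o<half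
  ... | no o≮half with m≤n⇒∃[o]m+o≡n o<N
  ...   | p , e = subst (λ n → SameLayer n o ⊎ SameLayer n (o + 2) ⊎ SameLayer n (o + 4)) e
                    (upper-half o p e p<quarter)
    where
    split : 3 + 8 * suc k ≡ suc (suc k) * 4 + suc (2 + k * 4)
    split = solve (k ∷ [])
    p<quarter : p < suc k * 4
    p<quarter = ≤-trans (+-cancelˡ-≤ (suc (suc k) * 4) (suc p) _
                  (≤-trans (+-monoˡ-≤ (suc p) (≮⇒≥ o≮half)) (≤-reflexive (trans (+-suc o p) (trans e split)))))
                  (n≤1+n _)

  5≤N : 5 ≤ N
  5≤N = ≤-trans (m≤m+n 5 6) (+-monoʳ-≤ 3 (*-monoʳ-≤ 8 (s≤s z≤n)))

  open Distance N 5≤N public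

  equidistant-pair : (x a : Fin N) →
    Equidistant x (a ⊕ 0) (a ⊕ 1) ⊎ Equidistant x (a ⊕ 2) (a ⊕ 3) ⊎ Equidistant x (a ⊕ 4) (a ⊕ 5)
  equidistant-pair x a with offset x a
  ... | o , o<N , refl with sameLayer-among-three o o<N
  ... | inj₁ S = inj₁ (sameLayer⇒equidistant x o 0 (subst (SameLayer N) (sym (+-identityʳ o)) S))
  ... | inj₂ (inj₁ S) = inj₂ (inj₁ (sameLayer⇒equidistant x o 2 S))
  ... | inj₂ (inj₂ S) = inj₂ (inj₂ (sameLayer⇒equidistant x o 4 S))

lemma3p24 : (k : ℕ) → 1 ≤ k → (a : Fin (3 + 8 * k)) → (X : Subset (3 + 8 * k)) →
    Resolves (3 + 8 * k) X (tupleA a) → 2 ≤ ∣ X ∣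
lemma3p24 (suc k) _ a X resolves = case equidistant-pair x a of λ where
    (inj₁ E) → equidistant⇒2≤∣X∣ x∈X d₀₁ E
    (inj₂ (inj₁ E)) → equidistant⇒2≤∣X∣ x∈X d₂₃ E
    (inj₂ (inj₂ E)) → equidistant⇒2≤∣X∣ x∈X d₄₅ E
  where
  open Order8k+3 k
  d₀₁ : Distinguishes N X (a ⊕ 0) (a ⊕ 1)
  d₀₁ = resolves _ (here refl) _ _ (here refl) (there (here refl)) (⊕-≢-⊕suc a 0)
  d₂₃ : Distinguishes N X (a ⊕ 2) (a ⊕ 3)
  d₂₃ = resolves _ (there (here refl)) _ _ (here refl) (there (here refl)) (⊕-≢-⊕suc a 2)
  d₄₅ : Distinguishes N X (a ⊕ 4) (a ⊕ 5)
  d₄₅ = resolves _ (there (there (here refl))) _ _ (here refl) (there (here refl)) (⊕-≢-⊕suc a 4)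
  x : Fin N
  x = proj₁ d₀₁
  x∈X : x ∈ X
  x∈X = proj₁ (proj₂ d₀₁)
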